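{- Let $G$ be a finite forest and let $M'$ be a minimal witness for $G$. Then in the coloring corresponding to $M'$, no element of $G$ is monochromatic; that is, every element is either bicolored or uncolored (so $M'$ is a principal submatrix of $M(G)$).
   Context: For a finite simple graph $G$, the elements of $G$ are its vertices and edges. Two elements $\alpha,\beta\in V(G)\cup E(G)$ are incident if $\alpha=\beta$, or one is an edge and the other is an endpoint of that edge. $M(G)$ is the $0/1$ matrix with rows and columns indexed by $V(G)\cup E(G)$ whose $(\alpha,\beta)$ entry is $1$ iff $\alpha$ and $\beta$ are incident. $\Delta(G)$ is the maximum of $|\det M'|$ over all square submatrices $M'$ of $M(G)$. A minimal witness for $G$ is a square submatrix $M'$ of $M(G)$ with $|\det M'|=\Delta(G)$ such that every proper square submatrix $M''$ of $M'$ satisfies $|\det M''|<|\det M'|$. The coloring corresponding to $M'$: an element is red if its row is a row of $M'$, cyan if its column is a column of $M'$; it is bicolored if it is both, monochromatic if it is exactly one of them, and uncolored if neither. -}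

module Defs where

open import Data.Nat using (ℕ; zero; suc; _<_; _≤_)
open import Data.Integer using (ℤ; +_; -_; _+_; _*_; ∣_∣)
open import Data.Fin using (Fin; zero; suc; punchIn; toℕ; _≟_)
open import Data.Sum using (_⊎_; inj₁; inj₂)
open import Data.Product using (Σ; _×_; _,_; proj₁; proj₂; ∃; ∃-syntax)
open import Data.Empty using (⊥)
open import Relation.Nullary using (¬_; yes; no)
open import Relation.Binary.PropositionalEquality using (_≡_; _≢_)
open import Function.Definitions using (Injective)

record Graph : Set where
  field
    n    : ℕ
    m    : ℕ
    ends : Fin m → Fin n × Fin n
    loopless : ∀ e → proj₁ (ends e) ≢ proj₂ (ends e)
    simple   : ∀ e e′ →
      ((proj₁ (ends e) ≡ proj₁ (ends e′) × proj₂ (ends e) ≡ proj₂ (ends e′)) ⊎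
       (proj₁ (ends e) ≡ proj₂ (ends e′) × proj₂ (ends e) ≡ proj₁ (ends e′))) →
      e ≡ e′

open Graph public

Adj : (G : Graph) → Fin (n G) → Fin (n G) → Set
Adj G u v = ∃[ e ] ((proj₁ (ends G e) ≡ u × proj₂ (ends G e) ≡ v) ⊎
                    (proj₁ (ends G e) ≡ v × proj₂ (ends G e) ≡ u))

-- successor modulo the cycle length (k+1 ↦ wraps to 0)
next : ∀ {k} → Fin (suc k) → Fin (suc k)
next {zero} zero = zero
next {suc k} zero = suc zero
next {suc k} (suc i) with next {k} i
... | zero = zero
... | suc j = suc (suc j)

Cycle : Graph → Set
Cycle G = Σ ℕ λ k → Σ (Fin (suc (suc (suc k))) → Fin (n G)) λ c →
  Injective _≡_ _≡_ c × (∀ i → Adj G (c i) (c (next i)))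

Forest : Graph → Set
Forest G = ¬ Cycle G

Elem : Graph → Set
Elem G = Fin (n G) ⊎ Fin (m G)

incidentV : (G : Graph) → Fin (n G) → Fin (m G) → ℤ
incidentV G v e with v ≟ proj₁ (ends G e) | v ≟ proj₂ (ends G e)
... | yes _ | _     = + 1
... | no _  | yes _ = + 1
... | no _  | no _  = + 0

eqV : ∀ {k} → Fin k → Fin k → ℤ
eqV a b with a ≟ b
... | yes _ = + 1
... | no _  = + 0

M : (G : Graph) → Elem G → Elem G → ℤ
M G (inj₁ u) (inj₁ v) = eqV u v
M G (inj₁ u) (inj₂ e) = incidentV G u e
M G (inj₂ e) (inj₁ u) = incidentV G u e
M G (inj₂ e) (inj₂ f) = eqV e f

Matrix : ℕ → Set
Matrix k = Fin k → Fin k → ℤ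

sign : ℕ → ℤ
sign zero = + 1
sign (suc zero) = - (+ 1)
sign (suc (suc i)) = sign i

Σf : ∀ {k} → (Fin k → ℤ) → ℤ
Σf {zero} f = + 0
Σf {suc k} f = f zero + Σf (λ i → f (suc i))

det : ∀ {k} → Matrix k → ℤ
det {zero} A = + 1
det {suc k} A = Σf λ j → sign (toℕ j) * (A zero j * det (λ a b → A (suc a) (punchIn j b)))

-- Square submatrices of M(G): an ordered choice of k distinct rows and
-- k distinct columns (|det| does not depend on the ordering).

record SqSub (G : Graph) : Set where
  constructor sqsub
  field
    size : ℕ
    rows : Fin size → Elem G
    cols : Fin size → Elem G
    rows-inj : Injective _≡_ _≡_ rows
    cols-inj : Injective _≡_ _≡_ cols

open SqSub public

matrixOf : {G : Graph} → (S : SqSub G) → Matrix (size S)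
matrixOf {G} S a b = M G (rows S a) (cols S b)

absDet : {G : Graph} → SqSub G → ℕ
absDet S = ∣ det (matrixOf S) ∣

IsΔ : Graph → ℕ → Set
IsΔ G d = (Σ (SqSub G) λ S → absDet S ≡ d) × (∀ (S : SqSub G) → absDet S ≤ d)

ProperSqSubOf : {G : Graph} → SqSub G → SqSub G → Set
ProperSqSubOf S′ S = size S′ < size S ×
  Σ (Fin (size S′) → Fin (size S)) λ r →
  Σ (Fin (size S′) → Fin (size S)) λ c →
    (∀ a → rows S′ a ≡ rows S (r a)) × (∀ b → cols S′ b ≡ cols S (c b))

MinimalWitness : (G : Graph) → SqSub G → Set
MinimalWitness G S = IsΔ G (absDet S) ×
  (∀ (S′ : SqSub G) → ProperSqSubOf S′ S → absDet S′ < absDet S)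

Red : {G : Graph} → SqSub G → Elem G → Set
Red S x = ∃[ i ] rows S i ≡ x

Cyan : {G : Graph} → SqSub G → Elem G → Set
Cyan S x = ∃[ i ] cols S i ≡ x

Monochromatic : {G : Graph} → SqSub G → Elem G → Set
Monochromatic S x = (Red S x × ¬ Cyan S x) ⊎ (Cyan S x × ¬ Red S x)

{-# OPTIONS --safe #-}
module Submission where

-- Suppose x is a row of M′ but not a column; the other case follows by transposing, since M(G)
-- is symmetric. In the Laplace expansion of det M′ along the row of x only columns y incident
-- with x contribute. As G is a forest, these neighbours of x lie in pairwise different components
-- of G − x, and since x is not a column, M′ without the row of x is block diagonal with respect
-- to these components. Nonsingular block-diagonal matrices have square blocks, so the cofactors
-- of two columns from different components cannot both be nonzero. Hence |det M′| is the absolute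
-- value of a single cofactor, i.e. of a proper minor (the entries of M(G) are 0 and 1), which
-- contradicts minimality.

open import Defs
open import Data.Bool using (Bool; true; false; not; if_then_else_)
import Data.Bool.Properties as Bool
open import Data.Empty using (⊥)
open import Data.Fin using (Fin; zero; suc; punchIn; toℕ; inject₁; fromℕ; _≟_)
open import Data.Fin.Properties using (punchInᵢ≢i; punchIn-injective; suc-injective; ¬∀⟶∃¬)
open import Data.Integer as ℤ using (ℤ; +_; -_; _+_; _*_; ∣_∣)
import Data.Integer.Properties as ℤ
open import Data.Integer.Tactic.RingSolver using (solve-∀)
open import Algebra.Properties.Semiring.Sum ℤ.+-*-semiring
  using (sum; sum-cong-≗; sum-remove; sum-replicate-zero; ∑-comm; *-distribˡ-sum)
open import Data.List using (List; []; _∷_; length; lookup)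
import Data.List.Membership.DecPropositional as DecMembership
open import Data.List.Membership.Propositional.Properties using (∈-lookup)
open import Data.List.Relation.Unary.All as All using (All; []; _∷_)
open import Data.List.Relation.Unary.All.Properties using (¬Any⇒All¬)
open import Data.List.Relation.Unary.AllPairs using (AllPairs; []; _∷_)
open import Data.List.Relation.Unary.Any using (here; there)
open import Data.List.Relation.Unary.Linked as Linked using (Linked; []; [-]; _∷_)
open import Data.Nat as ℕ using (ℕ; zero; suc; _<_; _≤_; z≤n; s≤s)
import Data.Nat.Properties as ℕ
open import Data.Product using (_×_; _,_; ∃-syntax; proj₁; proj₂)
open import Data.Sum using (_⊎_; inj₁; inj₂)
open import Data.Sum.Properties using (inj₁-injective)
open import Data.Vec.Functional using (updateAt)
open import Data.Vec.Functional.Properties using (updateAt-updates; updateAt-minimal)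
open import Function using (_∘_; _$_; const; id; _⇔_; mk⇔; Equivalence; Injective)
open import Relation.Nullary using (¬_; Dec; yes; no; does; contradiction; ¬¬-excluded-middle)
open import Relation.Nullary.Decidable using (dec-true; dec-false; does-⇔)
open import Relation.Binary.PropositionalEquality

open ≡-Reasoning

-- Determinants

Σf≡sum : ∀ {k} (f : Fin k → ℤ) → Σf f ≡ sum f
Σf≡sum {zero}  f = refl
Σf≡sum {suc k} f = cong (λ s → f zero + s) (Σf≡sum (f ∘ suc))

sum-zero : ∀ {k} {f : Fin k → ℤ} → (∀ i → f i ≡ + 0) → sum f ≡ + 0
sum-zero {k} f≡0 = trans (sum-cong-≗ f≡0) (sum-replicate-zero k)

sum-single : ∀ {k} (j : Fin (suc k)) (f : Fin (suc k) → ℤ) → (∀ i → i ≢ j → f i ≡ + 0) → sum f ≡ f j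
sum-single j f f≡0 = begin
  sum f                      ≡⟨ sum-remove f ⟩
  f j + sum (f ∘ punchIn j)  ≡⟨ cong (λ s → f j + s) (sum-zero (λ i → f≡0 _ (punchInᵢ≢i j i))) ⟩
  f j + + 0                  ≡⟨ ℤ.+-identityʳ (f j) ⟩
  f j                        ∎

sum-exchange : ∀ {m n} (w : Fin n → ℤ) (α : Fin m → ℤ) (Y : Fin m → Fin n → ℤ) →
               sum (λ j → w j * sum (λ t → α t * Y t j)) ≡ sum (λ t → α t * sum (λ j → w j * Y t j))
sum-exchange w α Y = begin
  sum (λ j → w j * sum (λ t → α t * Y t j))
    ≡⟨ sum-cong-≗ (λ j → *-distribˡ-sum (w j) (λ t → α t * Y t j)) ⟩
  sum (λ j → sum (λ t → w j * (α t * Y t j)))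
    ≡⟨ ∑-comm (λ j t → w j * (α t * Y t j)) ⟩
  sum (λ t → sum (λ j → w j * (α t * Y t j)))
    ≡⟨ sum-cong-≗ (λ t → sum-cong-≗ (λ j → swap (w j) (α t) (Y t j))) ⟩
  sum (λ t → sum (λ j → α t * (w j * Y t j)))
    ≡⟨ sum-cong-≗ (λ t → *-distribˡ-sum (α t) (λ j → w j * Y t j)) ⟨
  sum (λ t → α t * sum (λ j → w j * Y t j))
    ∎
  where
  swap : ∀ x y z → x * (y * z) ≡ y * (x * z)
  swap = solve-∀

*-distribˡ-sum₂ : ∀ {n} x y (f : Fin n → ℤ) → x * (y * sum f) ≡ sum (λ i → x * (y * f i))
*-distribˡ-sum₂ x y f = trans (cong (x *_) (*-distribˡ-sum y f)) (*-distribˡ-sum x (λ i → y * f i))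

sign-suc : ∀ n → sign (suc n) ≡ - sign n
sign-suc zero          = refl
sign-suc (suc zero)    = refl
sign-suc (suc (suc n)) = sign-suc n

∣sign∣≡1 : ∀ n → ∣ sign n ∣ ≡ 1
∣sign∣≡1 zero          = refl
∣sign∣≡1 (suc zero)    = refl
∣sign∣≡1 (suc (suc n)) = ∣sign∣≡1 n

eqV-refl : ∀ {k} (t : Fin k) → eqV t t ≡ + 1
eqV-refl t with t ≟ t
... | yes _   = refl
... | no t≢t = contradiction refl t≢t

eqV-≢ : ∀ {k} {t b : Fin k} → t ≢ b → eqV t b ≡ + 0
eqV-≢ {t = t} {b} t≢b with t ≟ b
... | yes t≡b = contradiction t≡b t≢b
... | no _    = refl

eqV≢0⇒≡ : ∀ {k} {a b : Fin k} → eqV a b ≢ + 0 → a ≡ b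
eqV≢0⇒≡ {a = a} {b} eqV≢0 with a ≟ b
... | yes a≡b = a≡b
... | no _    = contradiction refl eqV≢0

eqV-sym : ∀ {k} (a b : Fin k) → eqV a b ≡ eqV b a
eqV-sym a b with a ≟ b | b ≟ a
... | yes _   | yes _   = refl
... | no _    | no _    = refl
... | yes a≡b | no b≢a  = contradiction (sym a≡b) b≢a
... | no a≢b  | yes b≡a = contradiction (sym b≡a) a≢b

eqV-punchIn : ∀ {k} (c : Fin (suc k)) (j b : Fin k) → eqV (punchIn c j) (punchIn c b) ≡ eqV j b
eqV-punchIn c j b with j ≟ b
... | yes refl = eqV-refl (punchIn c j)
... | no j≢b   = eqV-≢ (j≢b ∘ punchIn-injective c j b)

-- Deleting column j and then column c of the result removes the same two columns as deleting
-- column punchIn j c and then column j′ (the new position of j); the signs of the two orders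
-- differ by −1.
punchIn-exchange : ∀ {k} (j : Fin (suc (suc k))) (c : Fin (suc k)) → ∃[ j′ ]
  punchIn (punchIn j c) j′ ≡ j ×
  (∀ b → punchIn (punchIn j c) (punchIn j′ b) ≡ punchIn j (punchIn c b)) ×
  sign (toℕ (punchIn j c)) * sign (toℕ j′) ≡ - (sign (toℕ j) * sign (toℕ c))
punchIn-exchange zero c rewrite sign-suc (toℕ c) = zero , refl , (λ _ → refl) , lemma (sign (toℕ c))
  where
  lemma : ∀ s → - s * + 1 ≡ - (+ 1 * s)
  lemma = solve-∀
punchIn-exchange (suc j) zero rewrite sign-suc (toℕ j) = j , refl , (λ _ → refl) , lemma (sign (toℕ j))
  where
  lemma : ∀ s → + 1 * s ≡ - (- s * + 1)
  lemma = solve-∀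
punchIn-exchange {suc k} (suc j) (suc c) with punchIn-exchange j c
... | j′ , back , commute , signs =
  suc j′ , cong suc back , (λ { zero → refl ; (suc b) → cong suc (commute b) }) , signs′
  where
  neg*neg : ∀ x y → - x * - y ≡ x * y
  neg*neg = solve-∀
  signs′ : sign (suc (toℕ (punchIn j c))) * sign (suc (toℕ j′)) ≡ - (sign (suc (toℕ j)) * sign (suc (toℕ c)))
  signs′ rewrite sign-suc (toℕ (punchIn j c)) | sign-suc (toℕ j′) | sign-suc (toℕ j) | sign-suc (toℕ c) =
    trans (neg*neg (sign (toℕ (punchIn j c))) (sign (toℕ j′)))
          (trans signs (cong -_ (sym (neg*neg (sign (toℕ j)) (sign (toℕ c))))))

minor : ∀ {k} → Matrix (suc k) → Fin (suc k) → Fin (suc k) → Matrix k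
minor A i j a b = A (punchIn i a) (punchIn j b)

cofactor : ∀ {k} → Matrix (suc k) → Fin (suc k) → Fin (suc k) → ℤ
cofactor A i j = sign (toℕ i) * sign (toℕ j) * det (minor A i j)

transpose : ∀ {k} → Matrix k → Matrix k
transpose A a b = A b a

det-expandFirstRow : ∀ {k} (A : Matrix (suc k)) →
                     det A ≡ sum (λ j → sign (toℕ j) * (A zero j * det (minor A zero j)))
det-expandFirstRow A = Σf≡sum (λ j → sign (toℕ j) * (A zero j * det (minor A zero j)))

det-cong : ∀ {k} {A B : Matrix k} → (∀ a b → A a b ≡ B a b) → det A ≡ det B
det-cong {zero}          A≡B = refl
det-cong {suc k} {A} {B} A≡B = begin
  det A
    ≡⟨ det-expandFirstRow A ⟩
  sum (λ j → sign (toℕ j) * (A zero j * det (minor A zero j)))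
    ≡⟨ sum-cong-≗ (λ j → cong₂ (λ x d → sign (toℕ j) * (x * d))
                                (A≡B zero j) (det-cong (λ a b → A≡B (suc a) (punchIn j b)))) ⟩
  sum (λ j → sign (toℕ j) * (B zero j * det (minor B zero j)))
    ≡⟨ det-expandFirstRow B ⟨
  det B
    ∎

cofactor≡0 : ∀ {k} (A : Matrix (suc k)) i j → det (minor A i j) ≡ + 0 → cofactor A i j ≡ + 0
cofactor≡0 A i j minor≡0 =
  trans (cong (sign (toℕ i) * sign (toℕ j) *_) minor≡0) (ℤ.*-zeroʳ (sign (toℕ i) * sign (toℕ j)))

entry*cofactor≢0 : ∀ {k} (A : Matrix (suc k)) i j → A i j * cofactor A i j ≢ + 0 →
                   A i j ≢ + 0 × det (minor A i j) ≢ + 0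
entry*cofactor≢0 A i j term≢0 =
  (λ entry≡0 → term≢0 (trans (cong (_* cofactor A i j) entry≡0) (ℤ.*-zeroˡ (cofactor A i j)))) ,
  (λ minor≡0 → term≢0 (trans (cong (A i j *_) (cofactor≡0 A i j minor≡0)) (ℤ.*-zeroʳ (A i j))))

∣cofactor∣ : ∀ {k} (A : Matrix (suc k)) i j → ∣ cofactor A i j ∣ ≡ ∣ det (minor A i j) ∣
∣cofactor∣ A i j = begin
  ∣ si * sj * d ∣              ≡⟨ ℤ.abs-* (si * sj) d ⟩
  ∣ si * sj ∣ ℕ.* ∣ d ∣        ≡⟨ cong (ℕ._* ∣ d ∣) (ℤ.abs-* si sj) ⟩
  ∣ si ∣ ℕ.* ∣ sj ∣ ℕ.* ∣ d ∣  ≡⟨ cong₂ (λ s t → s ℕ.* t ℕ.* ∣ d ∣) (∣sign∣≡1 (toℕ i)) (∣sign∣≡1 (toℕ j)) ⟩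
  1 ℕ.* 1 ℕ.* ∣ d ∣            ≡⟨ ℕ.*-identityˡ ∣ d ∣ ⟩
  ∣ d ∣                        ∎
  where
  si = sign (toℕ i)
  sj = sign (toℕ j)
  d  = det (minor A i j)

det-linearInRow : ∀ {k m} (i : Fin k) (A : Matrix k) (α : Fin m → ℤ) (B : Fin m → Matrix k) →
                  (∀ t a b → a ≢ i → B t a b ≡ A a b) → (∀ b → A i b ≡ sum (λ t → α t * B t i b)) →
                  det A ≡ sum (λ t → α t * det (B t))
det-linearInRow zero A α B agree row = begin
  det A
    ≡⟨ det-expandFirstRow A ⟩
  sum (λ j → sign (toℕ j) * (A zero j * D j))
    ≡⟨ sum-cong-≗ expand-entry ⟩
  sum (λ j → (sign (toℕ j) * D j) * sum (λ t → α t * B t zero j))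
    ≡⟨ sum-exchange (λ j → sign (toℕ j) * D j) α (λ t j → B t zero j) ⟩
  sum (λ t → α t * sum (λ j → (sign (toℕ j) * D j) * B t zero j))
    ≡⟨ sum-cong-≗ (λ t → cong (α t *_) (det-B t)) ⟩
  sum (λ t → α t * det (B t))
    ∎
  where
  D : Fin _ → ℤ
  D j = det (minor A zero j)
  reorder : ∀ s x d → s * (x * d) ≡ (s * d) * x
  reorder = solve-∀
  expand-entry : ∀ j → sign (toℕ j) * (A zero j * D j) ≡
                       (sign (toℕ j) * D j) * sum (λ t → α t * B t zero j)
  expand-entry j = trans (reorder (sign (toℕ j)) (A zero j) (D j)) (cong ((sign (toℕ j) * D j) *_) (row j))
  det-B : ∀ t → sum (λ j → (sign (toℕ j) * D j) * B t zero j) ≡ det (B t)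
  det-B t = sym (trans (det-expandFirstRow (B t)) (sum-cong-≗ λ j →
    trans (cong (λ d → sign (toℕ j) * (B t zero j * d)) (det-cong (λ a b → agree t (suc a) _ λ ())))
          (reorder (sign (toℕ j)) (B t zero j) (D j))))
det-linearInRow (suc i) A α B agree row = begin
  det A
    ≡⟨ det-expandFirstRow A ⟩
  sum (λ j → sign (toℕ j) * (A zero j * det (minor A zero j)))
    ≡⟨ sum-cong-≗ expand-minor ⟩
  sum (λ j → (sign (toℕ j) * A zero j) * sum (λ t → α t * D t j))
    ≡⟨ sum-exchange (λ j → sign (toℕ j) * A zero j) α D ⟩
  sum (λ t → α t * sum (λ j → (sign (toℕ j) * A zero j) * D t j))
    ≡⟨ sum-cong-≗ (λ t → cong (α t *_) (det-B t)) ⟩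
  sum (λ t → α t * det (B t))
    ∎
  where
  D : Fin _ → Fin _ → ℤ
  D t j = det (minor (B t) zero j)
  assoc : ∀ s x d → s * (x * d) ≡ (s * x) * d
  assoc = solve-∀
  expand-minor : ∀ j → sign (toℕ j) * (A zero j * det (minor A zero j)) ≡
                       (sign (toℕ j) * A zero j) * sum (λ t → α t * D t j)
  expand-minor j = trans (assoc (sign (toℕ j)) (A zero j) _) (cong ((sign (toℕ j) * A zero j) *_)
    (det-linearInRow i (minor A zero j) α (λ t → minor (B t) zero j)
                     (λ t a b a≢i → agree t (suc a) (punchIn j b) (a≢i ∘ suc-injective)) (row ∘ punchIn j)))
  det-B : ∀ t → sum (λ j → (sign (toℕ j) * A zero j) * D t j) ≡ det (B t)
  det-B t = sym (trans (det-expandFirstRow (B t)) (sum-cong-≗ λ j →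
    trans (assoc (sign (toℕ j)) (B t zero j) (D t j))
          (cong (λ x → (sign (toℕ j) * x) * D t j) (agree t zero j λ ()))))

det-zeroRow : ∀ {k} (A : Matrix k) (i : Fin k) → (∀ b → A i b ≡ + 0) → det A ≡ + 0
det-zeroRow A i row≡0 = det-linearInRow {m = 0} i A (λ ()) (λ ()) (λ ()) row≡0

det-unitFirstRow : ∀ {k} (A : Matrix (suc k)) (j : Fin (suc k)) → (∀ b → A zero b ≡ eqV j b) →
                   det A ≡ cofactor A zero j
det-unitFirstRow A j unit = begin
  det A                                        ≡⟨ det-expandFirstRow A ⟩
  sum (λ c → sign (toℕ c) * (A zero c * D c))  ≡⟨ sum-single j _ off-j ⟩
  sign (toℕ j) * (A zero j * D j)              ≡⟨ cong (λ x → sign (toℕ j) * (x * D j)) (trans (unit j) (eqV-refl j)) ⟩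
  sign (toℕ j) * (+ 1 * D j)                   ≡⟨ reorder (sign (toℕ j)) (D j) ⟩
  cofactor A zero j                            ∎
  where
  D : Fin _ → ℤ
  D c = det (minor A zero c)
  reorder : ∀ s d → s * (+ 1 * d) ≡ + 1 * s * d
  reorder = solve-∀
  vanish : ∀ s d → s * (+ 0 * d) ≡ + 0
  vanish = solve-∀
  off-j : ∀ c → c ≢ j → sign (toℕ c) * (A zero c * D c) ≡ + 0
  off-j c c≢j = trans (cong (λ x → sign (toℕ c) * (x * D c)) (trans (unit c) (eqV-≢ (c≢j ∘ sym))))
                      (vanish (sign (toℕ c)) (D c))

det-unitRow : ∀ {k} (A : Matrix (suc k)) (i j : Fin (suc k)) → (∀ b → A i b ≡ eqV j b) →
              det A ≡ cofactor A i j
det-unitRow A zero j unit = det-unitFirstRow A j unit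
det-unitRow {suc k} A (suc i) j unit = begin
  det A                      ≡⟨ det-expandFirstRow A ⟩
  sum T                      ≡⟨ sum-remove {i = j} T ⟩
  T j + sum (T ∘ punchIn j)  ≡⟨ cong₂ _+_ T-j≡0 (sum-cong-≗ T-punchIn) ⟩
  + 0 + sum (λ c → K * R c)  ≡⟨ ℤ.+-identityˡ _ ⟩
  sum (λ c → K * R c)        ≡⟨ *-distribˡ-sum K R ⟨
  K * sum R                  ≡⟨ cong (K *_) (det-expandFirstRow (minor A (suc i) j)) ⟨
  cofactor A (suc i) j       ∎
  where
  T : Fin (suc (suc k)) → ℤ
  T c = sign (toℕ c) * (A zero c * det (minor A zero c))
  K : ℤ
  K = sign (toℕ (suc i)) * sign (toℕ j)
  N : Fin (suc k) → ℤ
  N c = det (minor (minor A (suc i) j) zero c)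
  R : Fin (suc k) → ℤ
  R c = sign (toℕ c) * (A zero (punchIn j c) * N c)
  T-j≡0 : T j ≡ + 0
  T-j≡0 = trans (cong (λ d → sign (toℕ j) * (A zero j * d)) (det-zeroRow (minor A zero j) i zero-row))
                (vanish (sign (toℕ j)) (A zero j))
    where
    zero-row : ∀ b → A (suc i) (punchIn j b) ≡ + 0
    zero-row b = trans (unit (punchIn j b)) (eqV-≢ (punchInᵢ≢i j b ∘ sym))
    vanish : ∀ s x → s * (x * + 0) ≡ + 0
    vanish = solve-∀
  T-punchIn : ∀ c → T (punchIn j c) ≡ K * R c
  T-punchIn c with punchIn-exchange j c
  ... | j′ , back , commute , signs = begin
    T (punchIn j c)               ≡⟨ cong (λ d → p * (x * d)) minor-unit ⟩
    p * (x * (si * q * N c))      ≡⟨ factor p q si x (N c) ⟩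
    si * (p * q) * (x * N c)      ≡⟨ cong (λ z → si * z * (x * N c)) signs ⟩
    si * - (sj * sc) * (x * N c)  ≡⟨ unfactor si sj sc x (N c) ⟩
    - si * sj * (sc * (x * N c))  ≡⟨ cong (λ s → s * sj * R c) (sign-suc (toℕ i)) ⟨
    K * R c                       ∎
    where
    p  = sign (toℕ (punchIn j c))
    q  = sign (toℕ j′)
    si = sign (toℕ i)
    sj = sign (toℕ j)
    sc = sign (toℕ c)
    x  = A zero (punchIn j c)
    factor : ∀ p q si x n → p * (x * (si * q * n)) ≡ si * (p * q) * (x * n)
    factor = solve-∀
    unfactor : ∀ si sj sc x n → si * - (sj * sc) * (x * n) ≡ - si * sj * (sc * (x * n))
    unfactor = solve-∀
    minor-unit : det (minor A zero (punchIn j c)) ≡ si * q * N c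
    minor-unit = trans (det-unitRow (minor A zero (punchIn j c)) i j′ λ b →
                         trans (unit _) (trans (cong (λ t → eqV t _) (sym back)) (eqV-punchIn _ j′ b)))
                       (cong (si * q *_) (det-cong λ a b → cong (A _) (commute b)))

det-expandRow : ∀ {k} (A : Matrix (suc k)) (i : Fin (suc k)) → det A ≡ sum (λ j → A i j * cofactor A i j)
det-expandRow A i = begin
  det A                               ≡⟨ det-linearInRow i A (A i) E E-agree row-i ⟩
  sum (λ t → A i t * det (E t))       ≡⟨ sum-cong-≗ (λ t → cong (A i t *_) (det-E t)) ⟩
  sum (λ j → A i j * cofactor A i j)  ∎
  where
  E : Fin _ → Matrix _
  E t = updateAt A i (const (eqV t))
  E-agree : ∀ t a b → a ≢ i → E t a b ≡ A a b
  E-agree t a b a≢i = cong (_$ b) (updateAt-minimal a i A a≢i)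
  E-row : ∀ t b → E t i b ≡ eqV t b
  E-row t b = cong (_$ b) (updateAt-updates i A)
  det-E : ∀ t → det (E t) ≡ cofactor A i t
  det-E t = trans (det-unitRow (E t) i t (E-row t)) (cong (sign (toℕ i) * sign (toℕ t) *_)
                  (det-cong λ a b → E-agree t (punchIn i a) (punchIn t b) (punchInᵢ≢i i a)))
  row-i : ∀ b → A i b ≡ sum (λ t → A i t * E t i b)
  row-i b = sym (begin
    sum (λ t → A i t * E t i b)  ≡⟨ sum-single b _ (λ t t≢b → trans (cong (A i t *_) (trans (E-row t b) (eqV-≢ t≢b)))
                                                                     (ℤ.*-zeroʳ (A i t))) ⟩
    A i b * E b i b              ≡⟨ cong (A i b *_) (trans (E-row b b) (eqV-refl b)) ⟩
    A i b * + 1                  ≡⟨ ℤ.*-identityʳ (A i b) ⟩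
    A i b                        ∎)

det-expandFirstCol : ∀ {k} (A : Matrix (suc k)) →
                     det A ≡ sum (λ a → sign (toℕ a) * (A a zero * det (minor A a zero)))
det-expandFirstCol {zero}  A = refl
det-expandFirstCol {suc k} A = trans (det-expandFirstRow A) (cong (λ s → corner + s) exchange)
  where
  corner : ℤ
  corner = sign 0 * (A zero zero * det (minor A zero zero))
  σ σ⁺ top left : Fin (suc k) → ℤ
  σ  c = sign (toℕ c)
  σ⁺ c = sign (suc (toℕ c))
  top  c = A zero (suc c)
  left a = A (suc a) zero
  N : Fin (suc k) → Fin (suc k) → ℤ
  N a c = det (minor (minor A zero (suc c)) a zero)
  swap-signs : ∀ m n x y d → sign (suc m) * (x * (sign n * (y * d))) ≡ sign (suc n) * (y * (sign m * (x * d)))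
  swap-signs m n x y d rewrite sign-suc m | sign-suc n = lemma (sign m) (sign n) x y d
    where lemma : ∀ sm sn x y d → - sm * (x * (sn * (y * d))) ≡ - sn * (y * (sm * (x * d)))
          lemma = solve-∀
  exchange : sum (λ c → σ⁺ c * (top c * det (minor A zero (suc c)))) ≡
             sum (λ a → σ⁺ a * (left a * det (minor A (suc a) zero)))
  exchange = begin
    sum (λ c → σ⁺ c * (top c * det (minor A zero (suc c))))
      ≡⟨ sum-cong-≗ (λ c → cong (λ d → σ⁺ c * (top c * d)) (det-expandFirstCol (minor A zero (suc c)))) ⟩
    sum (λ c → σ⁺ c * (top c * sum (λ a → σ a * (left a * N a c))))
      ≡⟨ sum-cong-≗ (λ c → *-distribˡ-sum₂ (σ⁺ c) (top c) (λ a → σ a * (left a * N a c))) ⟩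
    sum (λ c → sum (λ a → σ⁺ c * (top c * (σ a * (left a * N a c)))))
      ≡⟨ ∑-comm (λ c a → σ⁺ c * (top c * (σ a * (left a * N a c)))) ⟩
    sum (λ a → sum (λ c → σ⁺ c * (top c * (σ a * (left a * N a c)))))
      ≡⟨ sum-cong-≗ (λ a → sum-cong-≗ (λ c → swap-signs (toℕ c) (toℕ a) (top c) (left a) (N a c))) ⟩
    sum (λ a → sum (λ c → σ⁺ a * (left a * (σ c * (top c * N a c)))))
      ≡⟨ sum-cong-≗ (λ a → *-distribˡ-sum₂ (σ⁺ a) (left a) (λ c → σ c * (top c * N a c))) ⟨
    sum (λ a → σ⁺ a * (left a * sum (λ c → σ c * (top c * N a c))))
      ≡⟨ sum-cong-≗ (λ a → cong (λ d → σ⁺ a * (left a * d)) (det-expandFirstRow (minor A (suc a) zero))) ⟨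
    sum (λ a → σ⁺ a * (left a * det (minor A (suc a) zero)))
      ∎

det-transpose : ∀ {k} (A : Matrix k) → det (transpose A) ≡ det A
det-transpose {zero}  A = refl
det-transpose {suc k} A = begin
  det (transpose A)
    ≡⟨ det-expandFirstRow (transpose A) ⟩
  sum (λ a → sign (toℕ a) * (A a zero * det (transpose (minor A a zero))))
    ≡⟨ sum-cong-≗ (λ a → cong (λ d → sign (toℕ a) * (A a zero * d)) (det-transpose (minor A a zero))) ⟩
  sum (λ a → sign (toℕ a) * (A a zero * det (minor A a zero)))
    ≡⟨ det-expandFirstCol A ⟨
  det A
    ∎

-- Block-diagonal matrices

count : ∀ {k} → (Fin k → Bool) → ℕ
count {zero}  P = 0
count {suc k} P = (if P zero then 1 else 0) ℕ.+ count (P ∘ suc)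

count-punchIn : ∀ {k} (j : Fin (suc k)) (P : Fin (suc k) → Bool) →
                count P ≡ (if P j then 1 else 0) ℕ.+ count (P ∘ punchIn j)
count-punchIn zero            P = refl
count-punchIn {suc k} (suc j) P = begin
  x ℕ.+ count (P ∘ suc)  ≡⟨ cong (x ℕ.+_) (count-punchIn j (P ∘ suc)) ⟩
  x ℕ.+ (y ℕ.+ z)        ≡⟨ ℕ.+-assoc x y z ⟨
  x ℕ.+ y ℕ.+ z          ≡⟨ cong (ℕ._+ z) (ℕ.+-comm x y) ⟩
  y ℕ.+ x ℕ.+ z          ≡⟨ ℕ.+-assoc y x z ⟩
  y ℕ.+ (x ℕ.+ z)        ∎
  where
  x = if P zero then 1 else 0
  y = if P (suc j) then 1 else 0
  z = count (P ∘ suc ∘ punchIn j)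

count-punchIn-true : ∀ {k} (j : Fin (suc k)) (P : Fin (suc k) → Bool) → P j ≡ true →
                     count P ≡ suc (count (P ∘ punchIn j))
count-punchIn-true j P Pj rewrite count-punchIn j P | Pj = refl

count-punchIn-false : ∀ {k} (j : Fin (suc k)) (P : Fin (suc k) → Bool) → P j ≡ false →
                      count P ≡ count (P ∘ punchIn j)
count-punchIn-false j P Pj rewrite count-punchIn j P | Pj = refl

count-complement : ∀ {k} (P : Fin k → Bool) → count P ℕ.+ count (not ∘ P) ≡ k
count-complement {zero}  P = refl
count-complement {suc k} P with P zero
... | true  = cong suc (count-complement (P ∘ suc))
... | false = trans (ℕ.+-suc (count (P ∘ suc)) _) (cong suc (count-complement (P ∘ suc)))

BlockDiagonal : ∀ {k} → Matrix k → (Fin k → Bool) → (Fin k → Bool) → Set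
BlockDiagonal N P Q = ∀ a b → P a ≢ Q b → N a b ≡ + 0

BlockDiagonalOffRow : ∀ {k} → Matrix k → Fin k → (Fin k → Bool) → (Fin k → Bool) → Set
BlockDiagonalOffRow A i P Q = ∀ a b → a ≢ i → P a ≢ Q b → A a b ≡ + 0

-- Along the first row, every term has an entry outside the blocks or a minor that is again
-- block diagonal with more P-rows than Q-columns.
blockDiagonal-unbalanced⇒det≡0 : ∀ {k} (N : Matrix k) (P Q : Fin k → Bool) → BlockDiagonal N P Q →
                                 count Q < count P → det N ≡ + 0
blockDiagonal-unbalanced⇒det≡0 {zero}  N P Q block ()
blockDiagonal-unbalanced⇒det≡0 {suc k} N P Q block Q<P = trans (det-expandFirstRow N) (sum-zero term≡0)
  where
  minor-unbalanced : ∀ c → P zero ≡ Q c → count (Q ∘ punchIn c) < count (P ∘ suc)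
  minor-unbalanced c P₀≡Qc = ℕ.+-cancelˡ-< (if Q c then 1 else 0) _ _
    (subst₂ _<_ (count-punchIn c Q) (cong (λ b → (if b then 1 else 0) ℕ.+ count (P ∘ suc)) P₀≡Qc) Q<P)
  entry-or-minor≡0 : ∀ c → N zero c ≡ + 0 ⊎ det (minor N zero c) ≡ + 0
  entry-or-minor≡0 c with P zero Bool.≟ Q c
  ... | no P₀≢Qc  = inj₁ (block zero c P₀≢Qc)
  ... | yes P₀≡Qc = inj₂ (blockDiagonal-unbalanced⇒det≡0 (minor N zero c) (P ∘ suc) (Q ∘ punchIn c)
                            (λ a b → block (suc a) (punchIn c b)) (minor-unbalanced c P₀≡Qc))
  vanish : ∀ s x d → x ≡ + 0 ⊎ d ≡ + 0 → s * (x * d) ≡ + 0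
  vanish s x d (inj₁ refl) = trans (cong (s *_) (ℤ.*-zeroˡ d)) (ℤ.*-zeroʳ s)
  vanish s x d (inj₂ refl) = trans (cong (s *_) (ℤ.*-zeroʳ x)) (ℤ.*-zeroʳ s)
  term≡0 : ∀ c → sign (toℕ c) * (N zero c * det (minor N zero c)) ≡ + 0
  term≡0 c = vanish (sign (toℕ c)) (N zero c) (det (minor N zero c)) (entry-or-minor≡0 c)

blockDiagonal-det≢0⇒balanced : ∀ {k} (N : Matrix k) (P Q : Fin k → Bool) → BlockDiagonal N P Q →
                               det N ≢ + 0 → count P ≡ count Q
blockDiagonal-det≢0⇒balanced N P Q block det≢0 = ℕ.≤-antisym P≤Q Q≤P
  where
  P≤Q : count P ≤ count Q
  P≤Q = ℕ.≮⇒≥ (det≢0 ∘ blockDiagonal-unbalanced⇒det≡0 N P Q block)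
  P̅≤Q̅ : count (not ∘ P) ≤ count (not ∘ Q)
  P̅≤Q̅ = ℕ.≮⇒≥ (det≢0 ∘ blockDiagonal-unbalanced⇒det≡0 N (not ∘ P) (not ∘ Q)
                                                        (λ a b P̅≢Q̅ → block a b (P̅≢Q̅ ∘ cong not)))
  Q≤P : count Q ≤ count P
  Q≤P = ℕ.+-cancelʳ-≤ (count (not ∘ Q)) (count Q) (count P)
          (ℕ.≤-trans (ℕ.≤-reflexive (trans (count-complement Q) (sym (count-complement P))))
                     (ℕ.+-monoʳ-≤ (count P) P̅≤Q̅))

minor-across-blocks-det≡0 : ∀ {k} (A : Matrix (suc k)) (i b₀ b : Fin (suc k)) (P Q : Fin (suc k) → Bool) →
                            BlockDiagonalOffRow A i P Q → Q b₀ ≡ true → Q b ≡ false →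
                            det (minor A i b₀) ≢ + 0 → det (minor A i b) ≡ + 0
minor-across-blocks-det≡0 A i b₀ b P Q block Q₀ Qb det₀≢0 with det (minor A i b) ℤ.≟ + 0
... | yes det≡0 = det≡0
... | no det≢0  = contradiction (begin
    suc (count (Q ∘ punchIn b₀))  ≡⟨ count-punchIn-true b₀ Q Q₀ ⟨
    count Q                       ≡⟨ count-punchIn-false b Q Qb ⟩
    count (Q ∘ punchIn b)         ≡⟨ balanced b det≢0 ⟨
    count (P ∘ punchIn i)         ≡⟨ balanced b₀ det₀≢0 ⟩
    count (Q ∘ punchIn b₀)        ∎) ℕ.1+n≢n
  where
  balanced : ∀ c → det (minor A i c) ≢ + 0 → count (P ∘ punchIn i) ≡ count (Q ∘ punchIn c)
  balanced c = blockDiagonal-det≢0⇒balanced (minor A i c) (P ∘ punchIn i) (Q ∘ punchIn c)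
                 (λ a c′ → block (punchIn i a) (punchIn c c′) (punchInᵢ≢i i a))

det-expandRow-singleBlock : ∀ {k} (A : Matrix (suc k)) (i b₀ : Fin (suc k)) (P Q : Fin (suc k) → Bool) →
                            BlockDiagonalOffRow A i P Q → Q b₀ ≡ true →
                            (∀ b → b ≢ b₀ → A i b ≢ + 0 → Q b ≡ false) → det (minor A i b₀) ≢ + 0 →
                            det A ≡ A i b₀ * cofactor A i b₀
det-expandRow-singleBlock A i b₀ P Q block Q₀ others det₀≢0 =
  trans (det-expandRow A i) (sum-single b₀ (λ b → A i b * cofactor A i b) term≡0)
  where
  term≡0 : ∀ b → b ≢ b₀ → A i b * cofactor A i b ≡ + 0
  term≡0 b b≢b₀ with A i b ℤ.≟ + 0
  ... | yes entry≡0 = trans (cong (_* cofactor A i b) entry≡0) (ℤ.*-zeroˡ (cofactor A i b))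
  ... | no entry≢0  = trans (cong (A i b *_) (cofactor≡0 A i b (minor-across-blocks-det≡0 A i b₀ b P Q block Q₀
                                                                     (others b b≢b₀ entry≢0) det₀≢0)))
                            (ℤ.*-zeroʳ (A i b))

-- Paths and components in G − x

data Last {A : Set} : List A → A → Set where
  last-[] : ∀ {z} → Last (z ∷ []) z
  last-∷  : ∀ {y z zs} → Last zs z → Last (y ∷ zs) z

module _ {A : Set} where

  lookup-injective : ∀ (xs : List A) → AllPairs _≢_ xs → ∀ {i j} → lookup xs i ≡ lookup xs j → i ≡ j
  lookup-injective (x ∷ xs) _                 {zero}  {zero}  _  = refl
  lookup-injective (x ∷ xs) (x∉xs ∷ _)        {zero}  {suc j} eq = contradiction eq (All.lookup x∉xs (∈-lookup j))
  lookup-injective (x ∷ xs) (x∉xs ∷ _)        {suc i} {zero}  eq = contradiction (sym eq) (All.lookup x∉xs (∈-lookup i))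
  lookup-injective (x ∷ xs) (_ ∷ xs-distinct) {suc i} {suc j} eq = cong suc (lookup-injective xs xs-distinct eq)

  Linked-lookup : ∀ {R : A → A → Set} (x : A) xs → Linked R (x ∷ xs) →
                  ∀ j → R (lookup (x ∷ xs) (inject₁ j)) (lookup xs j)
  Linked-lookup x (y ∷ ys) (r ∷ _)  zero    = r
  Linked-lookup x (y ∷ ys) (_ ∷ rs) (suc j) = Linked-lookup y ys rs j

  Last-lookup : ∀ {z : A} x xs → Last (x ∷ xs) z → lookup (x ∷ xs) (fromℕ (length xs)) ≡ z
  Last-lookup x []       last-[]       = refl
  Last-lookup x (y ∷ ys) (last-∷ last) = Last-lookup y ys last

next-cases : ∀ {K} (i : Fin (suc K)) → (i ≡ fromℕ K × next i ≡ zero) ⊎ ∃[ j ] (i ≡ inject₁ j × next i ≡ suc j)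
next-cases {zero}  zero    = inj₁ (refl , refl)
next-cases {suc K} zero    = inj₂ (zero , refl , refl)
next-cases {suc K} (suc i) with next i | next-cases i
... | .zero    | inj₁ (refl , refl)     = inj₁ (refl , refl)
... | .(suc j) | inj₂ (j , refl , refl) = inj₂ (suc j , refl , refl)

closedPath⇒Cycle : ∀ G {a b c z : Fin (n G)} rest → AllPairs _≢_ (a ∷ b ∷ c ∷ rest) →
                   Linked (Adj G) (a ∷ b ∷ c ∷ rest) → Last (a ∷ b ∷ c ∷ rest) z → Adj G z a → Cycle G
closedPath⇒Cycle G {a} {b} {c} rest distinct linked last closing =
  length rest , lookup vs , lookup-injective vs distinct , adjacent
  where
  vs : List (Fin (n G))
  vs = a ∷ b ∷ c ∷ rest
  adjacent : ∀ i → Adj G (lookup vs i) (lookup vs (next i))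
  adjacent i with next-cases i
  ... | inj₁ (refl , next≡0) rewrite next≡0 =
    subst (λ v → Adj G v a) (sym (Last-lookup a (b ∷ c ∷ rest) last)) closing
  ... | inj₂ (j , refl , next≡suc) rewrite next≡suc = Linked-lookup a (b ∷ c ∷ rest) linked j

module _ (G : Graph) where

  open DecMembership (_≟_ {n G}) using (_∈_; _∈?_)

  Endpoint : Fin (m G) → Fin (n G) → Set
  Endpoint f v = proj₁ (ends G f) ≡ v ⊎ proj₂ (ends G f) ≡ v

  Joins : Fin (m G) → Fin (n G) → Fin (n G) → Set
  Joins f a b = (proj₁ (ends G f) ≡ a × proj₂ (ends G f) ≡ b) ⊎ (proj₁ (ends G f) ≡ b × proj₂ (ends G f) ≡ a)

  Joins-sym : ∀ {f a b} → Joins f a b → Joins f b a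
  Joins-sym (inj₁ ab) = inj₂ ab
  Joins-sym (inj₂ ba) = inj₁ ba

  Joins-irreflexive : ∀ {f a b} → Joins f a b → a ≢ b
  Joins-irreflexive {f} (inj₁ (refl , refl)) = loopless G f
  Joins-irreflexive {f} (inj₂ (refl , refl)) = loopless G f ∘ sym

  Joins-endpoint : ∀ {f a b} → Joins f a b → Endpoint f b
  Joins-endpoint (inj₁ (_ , e₂)) = inj₂ e₂
  Joins-endpoint (inj₂ (e₁ , _)) = inj₁ e₁

  Joins-unique : ∀ {e f a b} → Joins e a b → Joins f a b → e ≡ f
  Joins-unique {e} {f} (inj₁ (refl , refl)) (inj₁ (e₁ , e₂)) = simple G e f (inj₁ (sym e₁ , sym e₂))
  Joins-unique {e} {f} (inj₁ (refl , refl)) (inj₂ (e₁ , e₂)) = simple G e f (inj₂ (sym e₂ , sym e₁))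
  Joins-unique {e} {f} (inj₂ (refl , refl)) (inj₁ (e₁ , e₂)) = simple G e f (inj₂ (sym e₂ , sym e₁))
  Joins-unique {e} {f} (inj₂ (refl , refl)) (inj₂ (e₁ , e₂)) = simple G e f (inj₁ (sym e₁ , sym e₂))

  endpoints⇒Joins : ∀ {f a b} → Endpoint f a → Endpoint f b → a ≢ b → Joins f a b
  endpoints⇒Joins (inj₁ e₁) (inj₁ e₂) a≢b = contradiction (trans (sym e₁) e₂) a≢b
  endpoints⇒Joins (inj₁ e₁) (inj₂ e₂) _   = inj₁ (e₁ , e₂)
  endpoints⇒Joins (inj₂ e₂) (inj₁ e₁) _   = inj₂ (e₁ , e₂)
  endpoints⇒Joins (inj₂ e₁) (inj₂ e₂) a≢b = contradiction (trans (sym e₁) e₂) a≢b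

  other-endpoint : ∀ {f v} → Endpoint f v → ∃[ w ] Joins f v w
  other-endpoint (inj₁ e₁) = _ , inj₁ (e₁ , refl)
  other-endpoint (inj₂ e₂) = _ , inj₂ (refl , e₂)

  incidentV≢0⇒Endpoint : ∀ {v f} → incidentV G v f ≢ + 0 → Endpoint f v
  incidentV≢0⇒Endpoint {v} {f} incident with v ≟ proj₁ (ends G f) | v ≟ proj₂ (ends G f)
  ... | yes v≡₁ | _       = inj₁ (sym v≡₁)
  ... | no _    | yes v≡₂ = inj₂ (sym v≡₂)
  ... | no _    | no _    = contradiction refl incident

  Incident : Fin (n G) → Elem G → Set
  Incident b (inj₁ u) = b ≡ u
  Incident b (inj₂ f) = Endpoint f b

  module Avoiding (x : Elem G) where

    Step : Fin (n G) → Fin (n G) → Set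
    Step a b = ∃[ f ] Joins f a b × inj₂ f ≢ x

    Step-sym : ∀ {a b} → Step a b → Step b a
    Step-sym (f , joins , f≢x) = f , Joins-sym joins , f≢x

    -- A simple path in G − x whose vertices, listed from b to r, are b ∷ rest.
    record Path (r b : Fin (n G)) : Set where
      constructor path
      field
        rest     : List (Fin (n G))
        distinct : AllPairs _≢_ (b ∷ rest)
        linked   : Linked Step (b ∷ rest)
        last     : Last (b ∷ rest) r
        avoids   : All (λ v → inj₁ v ≢ x) (b ∷ rest)

    trivial-path : ∀ {r} → inj₁ r ≢ x → Path r r
    trivial-path r≢x = path [] ([] ∷ []) [-] last-[] (r≢x ∷ [])

    suffix-path : ∀ {r u} vs → u ∈ vs → AllPairs _≢_ vs → Linked Step vs → Last vs r →
                  All (λ v → inj₁ v ≢ x) vs → Path r u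
    suffix-path (v ∷ vs)     (here refl) distinct linked last avoids = path vs distinct linked last avoids
    suffix-path (v ∷ w ∷ vs) (there u∈)  (_ ∷ distinct) linked (last-∷ last) (_ ∷ avoids) =
      suffix-path (w ∷ vs) u∈ distinct (Linked.tail linked) last avoids

    -- Loop erasure: if u already lies on the path, keep only the part of the path from u on.
    extend : ∀ {r b u} → Path r b → Step b u → inj₁ u ≢ x → Path r u
    extend {b = b} {u} (path vs distinct linked last avoids) step u≢x with u ∈? (b ∷ vs)
    ... | yes u∈ = suffix-path (b ∷ vs) u∈ distinct linked last avoids
    ... | no u∉  = path (b ∷ vs) (¬Any⇒All¬ (b ∷ vs) u∉ ∷ distinct) (Step-sym step ∷ linked)
                        (last-∷ last) (u≢x ∷ avoids)

    InComponent : Fin (n G) → Elem G → Set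
    InComponent r z = ∃[ b ] Incident b z × Path r b

    InComponent-endpoint : ∀ {r u f} → inj₁ u ≢ x → inj₂ f ≢ x → Endpoint f u →
                           InComponent r (inj₁ u) ⇔ InComponent r (inj₂ f)
    InComponent-endpoint {r} {u} {f} u≢x f≢x u∈f = mk⇔ to from
      where
      to : InComponent r (inj₁ u) → InComponent r (inj₂ f)
      to (b , refl , p) = b , u∈f , p
      from : InComponent r (inj₂ f) → InComponent r (inj₁ u)
      from (b , b∈f , p) with b ≟ u
      ... | yes b≡u = b , b≡u , p
      ... | no b≢u  = u , refl , extend p (f , endpoints⇒Joins b∈f u∈f b≢u , f≢x) u≢x

    InComponent-incidence : ∀ {r} ρ c → ρ ≢ x → c ≢ x → M G ρ c ≢ + 0 → InComponent r ρ ⇔ InComponent r c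
    InComponent-incidence (inj₁ u) (inj₁ v) _ _ M≢0 with eqV≢0⇒≡ M≢0
    ... | refl = mk⇔ id id
    InComponent-incidence (inj₂ e) (inj₂ f) _ _ M≢0 with eqV≢0⇒≡ M≢0
    ... | refl = mk⇔ id id
    InComponent-incidence (inj₁ u) (inj₂ f) u≢x f≢x M≢0 = InComponent-endpoint u≢x f≢x (incidentV≢0⇒Endpoint M≢0)
    InComponent-incidence (inj₂ f) (inj₁ u) f≢x u≢x M≢0 =
      mk⇔ (Equivalence.from u⇔f) (Equivalence.to u⇔f)
      where u⇔f = InComponent-endpoint u≢x f≢x (incidentV≢0⇒Endpoint M≢0)

  open Avoiding using (Path; path; InComponent; trivial-path)

  Step⇒Adj : ∀ {x a b} → Avoiding.Step x a b → Adj G a b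
  Step⇒Adj (f , joins , _) = f , joins

  Neighbour : Elem G → Elem G → Set
  Neighbour x y = y ≢ x × M G x y ≢ + 0

  module _ (forest : Forest G) where

    forest-edge-bridge : ∀ {e a b} → Joins e a b → ¬ Path (inj₂ e) a b
    forest-edge-bridge e-ab (path [] _ _ last-[] _) = Joins-irreflexive e-ab refl
    forest-edge-bridge e-ab (path (_ ∷ []) _ ((f , f-ba , f≢e) ∷ [-]) (last-∷ last-[]) _) =
      f≢e (cong inj₂ (Joins-unique (Joins-sym f-ba) e-ab))
    forest-edge-bridge {e} e-ab (path (_ ∷ _ ∷ rest) distinct linked last _) =
      forest (closedPath⇒Cycle G rest distinct (Linked.map Step⇒Adj linked) last (e , e-ab))

    forest-vertex-cut : ∀ {v f₀ f w₀ w} → Joins f₀ v w₀ → Joins f v w → f ≢ f₀ → ¬ Path (inj₁ v) w₀ w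
    forest-vertex-cut f₀-vw₀ f-vw f≢f₀ (path [] _ _ last-[] _) = f≢f₀ (Joins-unique f-vw f₀-vw₀)
    forest-vertex-cut {f₀ = f₀} {f} f₀-vw₀ f-vw f≢f₀ (path (_ ∷ rest) distinct linked last avoids) =
      forest (closedPath⇒Cycle G rest (All.map (λ u≢v v≡u → u≢v (cong inj₁ (sym v≡u))) avoids ∷ distinct)
                                      ((f , f-vw) ∷ Linked.map Step⇒Adj linked) (last-∷ last) (f₀ , Joins-sym f₀-vw₀))

    neighbours-separated : ∀ x y₀ → Neighbour x y₀ →
      ∃[ r ] InComponent x r y₀ × (∀ y → Neighbour x y → y ≢ y₀ → ¬ InComponent x r y)
    neighbours-separated (inj₁ v) (inj₁ _) (y₀≢x , M≢0) = contradiction (cong inj₁ (sym (eqV≢0⇒≡ M≢0))) y₀≢x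
    neighbours-separated (inj₂ e) (inj₂ _) (y₀≢x , M≢0) = contradiction (cong inj₂ (sym (eqV≢0⇒≡ M≢0))) y₀≢x
    neighbours-separated (inj₁ v) (inj₂ f₀) (_ , M≢0) with other-endpoint (incidentV≢0⇒Endpoint M≢0)
    ... | w₀ , f₀-vw₀ =
      w₀ , (w₀ , Joins-endpoint f₀-vw₀ , trivial-path (inj₁ v) (w₀≢v ∘ inj₁-injective)) , others
      where
      w₀≢v : w₀ ≢ v
      w₀≢v = Joins-irreflexive f₀-vw₀ ∘ sym
      others : ∀ y → Neighbour (inj₁ v) y → y ≢ inj₂ f₀ → ¬ InComponent (inj₁ v) w₀ y
      others (inj₁ _) (y≢x , M′≢0) _ = contradiction (cong inj₁ (sym (eqV≢0⇒≡ M′≢0))) y≢x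
      others (inj₂ f) (_ , M′≢0) f≢f₀ (b , b∈f , p) =
        forest-vertex-cut f₀-vw₀ (endpoints⇒Joins (incidentV≢0⇒Endpoint M′≢0) b∈f v≢b) (f≢f₀ ∘ cong inj₂) p
        where
        v≢b : v ≢ b
        v≢b v≡b = All.head (Path.avoids p) (cong inj₁ (sym v≡b))
    neighbours-separated (inj₂ e) (inj₁ u) (_ , M≢0) = u , (u , refl , trivial-path (inj₂ e) (λ ())) , others
      where
      others : ∀ y → Neighbour (inj₂ e) y → y ≢ inj₁ u → ¬ InComponent (inj₂ e) u y
      others (inj₂ _) (y≢x , M′≢0) _ = contradiction (cong inj₂ (sym (eqV≢0⇒≡ M′≢0))) y≢x
      others (inj₁ u′) (_ , M′≢0) u′≢u (_ , refl , p) =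
        forest-edge-bridge (endpoints⇒Joins (incidentV≢0⇒Endpoint M≢0) (incidentV≢0⇒Endpoint M′≢0)
                                            (u′≢u ∘ cong inj₁ ∘ sym)) p

-- Minimal witnesses

M-sym : ∀ G α β → M G α β ≡ M G β α
M-sym G (inj₁ u) (inj₁ v) = eqV-sym u v
M-sym G (inj₁ u) (inj₂ f) = refl
M-sym G (inj₂ f) (inj₁ u) = refl
M-sym G (inj₂ e) (inj₂ f) = eqV-sym e f

eqV≢0⇒≡1 : ∀ {k} {a b : Fin k} → eqV a b ≢ + 0 → eqV a b ≡ + 1
eqV≢0⇒≡1 eqV≢0 rewrite eqV≢0⇒≡ eqV≢0 = eqV-refl _

incidentV≢0⇒≡1 : ∀ G {v f} → incidentV G v f ≢ + 0 → incidentV G v f ≡ + 1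
incidentV≢0⇒≡1 G {v} {f} incident with v ≟ proj₁ (ends G f) | v ≟ proj₂ (ends G f)
... | yes _ | _     = refl
... | no _  | yes _ = refl
... | no _  | no _  = contradiction refl incident

M≢0⇒≡1 : ∀ G α β → M G α β ≢ + 0 → M G α β ≡ + 1
M≢0⇒≡1 G (inj₁ u) (inj₁ v) = eqV≢0⇒≡1
M≢0⇒≡1 G (inj₁ u) (inj₂ f) = incidentV≢0⇒≡1 G
M≢0⇒≡1 G (inj₂ f) (inj₁ u) = incidentV≢0⇒≡1 G
M≢0⇒≡1 G (inj₂ e) (inj₂ f) = eqV≢0⇒≡1

¬¬-decidable : ∀ {k} (P : Fin k → Set) → ¬ ¬ (∀ i → Dec (P i))
¬¬-decidable {zero}  P ¬dec = ¬dec (λ ())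
¬¬-decidable {suc k} P ¬dec = ¬¬-excluded-middle λ P₀? →
  ¬¬-decidable (P ∘ suc) λ P₊? → ¬dec λ { zero → P₀? ; (suc i) → P₊? i }

minimalWitness-det≢0 : ∀ {G} {S : SqSub G} → MinimalWitness G S → det (matrixOf S) ≢ + 0
minimalWitness-det≢0 {S = sqsub zero _ _ _ _}    _             ()
minimalWitness-det≢0 {S = sqsub (suc k) _ _ _ _} (_ , minimal) det≡0 =
  ℕ.n≮0 (subst (1 ℕ.<_) (cong ∣_∣ det≡0) (minimal empty (s≤s z≤n , (λ ()) , (λ ()) , (λ ()) , (λ ()))))
  where
  empty = sqsub 0 (λ ()) (λ ()) (λ { {()} }) (λ { {()} })

module _ {G : Graph} {k : ℕ} {rows cols : Fin (suc k) → Elem G}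
         {rows-inj : Injective _≡_ _≡_ rows} {cols-inj : Injective _≡_ _≡_ cols} where

  private
    S : SqSub G
    S = sqsub (suc k) rows cols rows-inj cols-inj
    A : Matrix (suc k)
    A = matrixOf S

  minimalWitness-minor< : MinimalWitness G S → ∀ i j → ∣ det (minor A i j) ∣ < absDet S
  minimalWitness-minor< (_ , minimal) i j =
    minimal minorSub (ℕ.n<1+n k , punchIn i , punchIn j , (λ _ → refl) , (λ _ → refl))
    where
    minorSub : SqSub G
    minorSub = sqsub k (rows ∘ punchIn i) (cols ∘ punchIn j)
                     (punchIn-injective i _ _ ∘ rows-inj) (punchIn-injective j _ _ ∘ cols-inj)

  minimalWitness-¬single-term : MinimalWitness G S → ∀ i j → A i j ≢ + 0 → det A ≢ A i j * cofactor A i j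
  minimalWitness-¬single-term W i j A-ij≢0 det≡term = ℕ.<-irrefl (sym ∣det∣≡) (minimalWitness-minor< W i j)
    where
    ∣det∣≡ : absDet S ≡ ∣ det (minor A i j) ∣
    ∣det∣≡ = begin
      ∣ det A ∣                   ≡⟨ cong ∣_∣ det≡term ⟩
      ∣ A i j * cofactor A i j ∣  ≡⟨ cong (λ a → ∣ a * cofactor A i j ∣) (M≢0⇒≡1 G (rows i) (cols j) A-ij≢0) ⟩
      ∣ + 1 * cofactor A i j ∣    ≡⟨ cong ∣_∣ (ℤ.*-identityˡ (cofactor A i j)) ⟩
      ∣ cofactor A i j ∣          ≡⟨ ∣cofactor∣ A i j ⟩
      ∣ det (minor A i j) ∣       ∎

  column-neighbour : ∀ {x} i → rows i ≡ x → ¬ Cyan S x → ∀ b → A i b ≢ + 0 → Neighbour G x (cols b)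
  column-neighbour i refl ¬cyan b A-ib≢0 = (λ cols-b≡x → ¬cyan (b , cols-b≡x)) , A-ib≢0

  -- Whether the rows and columns satisfy C is only decided under double negation, which is
  -- enough because the conclusion is itself negated.
  separated⇒single-term : ∀ {x} i → rows i ≡ x → ¬ Cyan S x → (C : Elem G → Set) →
                          (∀ ρ c → ρ ≢ x → c ≢ x → M G ρ c ≢ + 0 → C ρ ⇔ C c) →
                          ∀ b₀ → C (cols b₀) → (∀ b → b ≢ b₀ → A i b ≢ + 0 → ¬ C (cols b)) →
                          det (minor A i b₀) ≢ + 0 → ¬ ¬ (det A ≡ A i b₀ * cofactor A i b₀)
  separated⇒single-term i refl ¬cyan C respects b₀ C-b₀ ¬C-others minor≢0 ¬expansion =
    ¬¬-decidable (C ∘ rows) λ C-rows? → ¬¬-decidable (C ∘ cols) λ C-cols? → ¬expansion (expansion C-rows? C-cols?)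
    where
    expansion : (∀ a → Dec (C (rows a))) → (∀ c → Dec (C (cols c))) → det A ≡ A i b₀ * cofactor A i b₀
    expansion C-rows? C-cols? = det-expandRow-singleBlock A i b₀ P Q block (dec-true (C-cols? b₀) C-b₀)
      (λ b b≢b₀ A-ib≢0 → dec-false (C-cols? b) (¬C-others b b≢b₀ A-ib≢0)) minor≢0
      where
      P Q : Fin (suc k) → Bool
      P = does ∘ C-rows?
      Q = does ∘ C-cols?
      block : BlockDiagonalOffRow A i P Q
      block a c a≢i P≢Q with A a c ℤ.≟ + 0
      ... | yes A-ac≡0 = A-ac≡0
      ... | no A-ac≢0  = contradiction (does-⇔ (respects (rows a) (cols c) (a≢i ∘ rows-inj) (¬cyan ∘ (c ,_)) A-ac≢0)
                                              (C-rows? a) (C-cols? c)) P≢Q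

  red-only-impossible : Forest G → MinimalWitness G S → ∀ {x} → Red S x → ¬ Cyan S x → ⊥
  red-only-impossible forest W {x} (i , rows-i≡x) ¬cyan
    with ¬∀⟶∃¬ (suc k) (λ b → A i b * cofactor A i b ≡ + 0) (λ b → A i b * cofactor A i b ℤ.≟ + 0)
               (minimalWitness-det≢0 {S = S} W ∘ trans (det-expandRow A i) ∘ sum-zero)
  ... | b₀ , term≢0 with entry*cofactor≢0 A i b₀ term≢0
  ... | entry≢0 , minor≢0 with neighbours-separated G forest x (cols b₀) (column-neighbour i rows-i≡x ¬cyan b₀ entry≢0)
  ... | r , b₀-in , others-out =
    separated⇒single-term i rows-i≡x ¬cyan (Avoiding.InComponent G x r) (Avoiding.InComponent-incidence G x) b₀ b₀-in
      (λ b b≢b₀ A-ib≢0 → others-out (cols b) (column-neighbour i rows-i≡x ¬cyan b A-ib≢0) (b≢b₀ ∘ cols-inj))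
      minor≢0 (minimalWitness-¬single-term W i b₀ entry≢0)

no-red-only-element : ∀ {G} → Forest G → (S : SqSub G) → MinimalWitness G S → ∀ {x} → Red S x → ¬ Cyan S x → ⊥
no-red-only-element forest (sqsub zero _ _ _ _) W (() , _)
no-red-only-element forest (sqsub (suc k) rows cols rows-inj cols-inj) W =
  red-only-impossible {rows = rows} {cols} {rows-inj} {cols-inj} forest W

transposeSub : ∀ {G} → SqSub G → SqSub G
transposeSub S = sqsub (size S) (cols S) (rows S) (cols-inj S) (rows-inj S)

absDet-transposeSub : ∀ {G} (S : SqSub G) → absDet (transposeSub S) ≡ absDet S
absDet-transposeSub {G} S =
  cong ∣_∣ (trans (det-cong (λ a b → M-sym G (cols S a) (rows S b))) (det-transpose (matrixOf S)))

minimalWitness-transposeSub : ∀ {G} (S : SqSub G) → MinimalWitness G S → MinimalWitness G (transposeSub S)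
minimalWitness-transposeSub S ((_ , maximal) , minimal) =
  ((S , sym Sᵀ≡S) , λ S′ → subst (absDet S′ ≤_) (sym Sᵀ≡S) (maximal S′)) ,
  λ { S′ (smaller , r , c , rows≡ , cols≡) →
        subst₂ _<_ (absDet-transposeSub S′) (sym Sᵀ≡S) (minimal (transposeSub S′) (smaller , c , r , cols≡ , rows≡)) }
  where
  Sᵀ≡S = absDet-transposeSub S

lemma11 : (G : Graph) → Forest G → (S : SqSub G) → MinimalWitness G S →
    (x : Elem G) → ¬ Monochromatic S x
lemma11 G forest S W x (inj₁ (red , ¬cyan)) = no-red-only-element forest S W red ¬cyan
lemma11 G forest S W x (inj₂ (cyan , ¬red)) =
  no-red-only-element forest (transposeSub S) (minimalWitness-transposeSub S W) cyan ¬red
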